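{- Let $m\ge 2$ be an integer. Then $\chi'_g(W_3;m,1)=3$, and \[ \chi'_g(W_4;m,1)=\begin{cases} 4 & \text{if } m\neq 3,\\ 5 & \text{if } m=3.\end{cases} \]
   Context: For $n\ge 3$, the wheel $W_n$ is the graph with $n+1$ vertices obtained from the cycle $C_n$ by adding a new vertex $v_0$ adjacent to every vertex of the cycle. The $(m,1)$-edge coloring game on a finite simple graph $G$ with a set of colors $X$ is played alternately by two players, Maker and Breaker, with Maker playing first. On each turn Maker makes $m$ moves and Breaker makes one move; a move consists of coloring one uncolored edge of $G$ with a color from $X$ so that adjacent edges (edges sharing an endpoint) always receive distinct colors. Maker wins if eventually every edge is colored; Breaker wins if at some point the player who is to move cannot color any edge. The $(m,1)$-game chromatic index $\chi'_g(G;m,1)$ is the smallest nonnegative integer $k$ such that Maker has a winning strategy when $|X|=k$. -}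

module Defs where

open import Data.Nat using (ℕ; zero; suc; _+_; _≤_)
open import Data.Nat.DivMod using (_mod_)
open import Data.Fin using (Fin; zero; suc; toℕ; splitAt; _≟_)
open import Data.Maybe using (Maybe; just; nothing)
open import Data.Product using (_×_; _,_; proj₁; proj₂; ∃; ∃-syntax)
open import Data.Sum using (_⊎_; [_,_])
open import Relation.Binary.PropositionalEquality using (_≡_; _≢_)
open import Relation.Nullary using (¬_; yes; no)

record Graph : Set where
  field
    V : ℕ
    E : ℕ
    ends : Fin E → Fin V × Fin V

open Graph public

Incident : (G : Graph) → Fin (V G) → Fin (E G) → Set
Incident G v e = v ≡ proj₁ (ends G e) ⊎ v ≡ proj₂ (ends G e)

Adjacent : (G : Graph) → Fin (E G) → Fin (E G) → Set
Adjacent G e f = e ≢ f × ∃[ v ] (Incident G v e × Incident G v f)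

cycNext : ∀ {n} → Fin n → Fin n
cycNext {suc n} i = suc (toℕ i) mod suc n

-- The wheel W_n: vertex 0 is the hub v0, vertices 1..n form the cycle C_n.
-- Edges 0..n-1 are the spokes v0–v_{i+1}; edges n..2n-1 are the rim edges
-- v_{i+1}–v_{(i+1 mod n)+1}.
wheel : ℕ → Graph
wheel n = record
  { V = suc n
  ; E = n + n
  ; ends = λ e → [ (λ i → zero , suc i) , (λ i → suc i , suc (cycNext i)) ] (splitAt n e)
  }

State : Graph → ℕ → Set
State G k = Fin (E G) → Maybe (Fin k)

empty : ∀ {G k} → State G k
empty _ = nothing

update : ∀ {G k} → State G k → Fin (E G) → Fin k → State G k
update s e c f with f ≟ e
... | yes _ = just c
... | no _ = s f

Complete : ∀ {G k} → State G k → Set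
Complete {G} s = ∀ (e : Fin (E G)) → s e ≢ nothing

Legal : ∀ {G k} → State G k → Fin (E G) → Fin k → Set
Legal {G} s e c = s e ≡ nothing × (∀ f → Adjacent G e f → s f ≢ just c)

-- Positions: Maker to move with r moves left in the current turn, or Breaker to move.
data Turn : Set where
  makerTurn : ℕ → Turn
  breakerTurn : Turn

afterMaker : ℕ → Turn
afterMaker zero = breakerTurn
afterMaker (suc r) = makerTurn (suc r)

-- Maker wins once every edge is
-- coloured; if the game is incomplete and the player to move has no legal move,
-- Breaker wins (no constructor applies).
data MakerWins (G : Graph) (m k : ℕ) : Turn → State G k → Set where
  done : ∀ {t s} → Complete {G} {k} s → MakerWins G m k t s
  maker : ∀ {r s} (e : Fin (E G)) (c : Fin k) → Legal {G} s e c →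
          MakerWins G m k (afterMaker r) (update {G} s e c) →
          MakerWins G m k (makerTurn (suc r)) s
  breaker : ∀ {s} → (∃[ e ] ∃[ c ] Legal {G} {k} s e c) →
            (∀ e c → Legal {G} s e c → MakerWins G m k (makerTurn m) (update {G} s e c)) →
            MakerWins G m k breakerTurn s

MakerWinsGame : Graph → ℕ → ℕ → Set
MakerWinsGame G m k = MakerWins G m k (makerTurn m) (empty {G})

GameChromaticIndex≡ : Graph → ℕ → ℕ → Set
GameChromaticIndex≡ G m k = MakerWinsGame G m k × (∀ j → suc j ≤ k → ¬ MakerWinsGame G m j)

{-# OPTIONS --safe #-}

-- The n spokes of W_n pairwise meet at the hub, so by pigeonhole every proper
-- edge colouring of W_n uses at least n colours; and any position from which
-- Maker wins extends to a proper complete colouring, since play only ever adds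
-- legal colours.  This gives all lower bounds except the one for the
-- (3,1)-game on W_4 with 4 colours.  The remaining statements concern finite
-- games and are settled by exhaustive search with proved-sound evaluators:
-- Maker's wins for 2 ≤ m < |E| (for m ≥ |E| she colours every edge in her first
-- turn), and Breaker's win in the (3,1)-game on W_4 with 4 colours, where after
-- any first turn of Maker, Breaker has a move leaving no proper completion.
-- Permuting colours, Maker's first move may be assumed to use colour 0.

module Submission where

open import Defs
open import Data.Bool using (Bool; true; false; T; not; _∧_; _∨_)
open import Data.Bool.Properties using (T-∧; T-∨)
open import Data.Fin using (Fin; zero; suc; _≟_; _↑ˡ_)
open import Data.Fin.Permutation using (Permutation′; _⟨$⟩ʳ_; _⟨$⟩ˡ_; inverseˡ; inverseʳ; transpose)
open import Data.Fin.Properties using (all?; pigeonhole; splitAt-↑ˡ; ↑ˡ-injective; <⇒≢)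
open import Data.List using (List; []; _∷_; allFin; length)
open import Data.List.Membership.Propositional using (_∈_)
open import Data.List.Membership.Propositional.Properties using (∈-allFin)
open import Data.List.Properties using (length-tabulate)
open import Data.List.Relation.Unary.Any using (here; there)
open import Data.Maybe using (just; nothing)
import Data.Maybe as Maybe
open import Data.Maybe.Properties using (just-injective; map-nothing; ≡-dec)
open import Data.Nat using (ℕ; zero; suc; _≤_; _<_; z≤n; s≤s)
open import Data.Nat.Properties using (≤-pred; ≤-trans; ≤-antisym; n≤1+n; m≤m+n; ≮⇒≥; <⇒≱)
open import Data.Product using (_×_; _,_; proj₁; proj₂; ∃; ∃-syntax)
open import Data.Sum using (_⊎_; inj₁; inj₂)
open import Function using (_∘_; id; flip)
open import Function.Bundles using (Equivalence)
open import Relation.Binary using (Decidable)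
open import Relation.Binary.PropositionalEquality
  using (_≡_; _≢_; _≗_; refl; sym; trans; cong; subst; module ≡-Reasoning)
open import Relation.Nullary using (¬_; Dec; _because_; does; yes; no; ¬?; _×-dec_; _⊎-dec_; _→-dec_; contradiction)
open import Relation.Nullary.Decidable using (map′; dec-true)
open import Relation.Nullary.Reflects using (invert)

open ≡-Reasoning

anyᶠ : ∀ {n} → (Fin n → Bool) → Bool
anyᶠ {zero}  p = false
anyᶠ {suc n} p = p zero ∨ anyᶠ (p ∘ suc)

allᶠ : ∀ {n} → (Fin n → Bool) → Bool
allᶠ {zero}  p = true
allᶠ {suc n} p = p zero ∧ allᶠ (p ∘ suc)

anyᶠ⁻ : ∀ {n} (p : Fin n → Bool) → T (anyᶠ p) → ∃ (T ∘ p)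
anyᶠ⁻ {suc n} p h with Equivalence.to T-∨ h
... | inj₁ p₀ = zero , p₀
... | inj₂ ps = let i , pᵢ = anyᶠ⁻ (p ∘ suc) ps in suc i , pᵢ

allᶠ⁻ : ∀ {n} (p : Fin n → Bool) → T (allᶠ p) → ∀ i → T (p i)
allᶠ⁻ p h zero    = proj₁ (Equivalence.to T-∧ h)
allᶠ⁻ p h (suc i) = allᶠ⁻ (p ∘ suc) (proj₂ (Equivalence.to T-∧ h)) i

T-⇒ : ∀ {a b} → T (not a ∨ b) → T a → T b
T-⇒ {true} b _ = b

does⇒ : ∀ {P : Set} (P? : Dec P) → T (does P?) → P
does⇒ (true because [p]) _ = invert [p]

⇒does : ∀ {P : Set} (P? : Dec P) → P → T (does P?)
⇒does (true  because _)    _ = _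
⇒does (false because [¬p]) p = invert [¬p] p

Adjacent-sym : ∀ {G e f} → Adjacent G e f → Adjacent G f e
Adjacent-sym (e≢f , v , v∈e , v∈f) = e≢f ∘ sym , v , v∈f , v∈e

incident? : (G : Graph) → ∀ v e → Dec (Incident G v e)
incident? G v e = (v ≟ proj₁ (ends G e)) ⊎-dec (v ≟ proj₂ (ends G e))

commonEnd? : (G : Graph) → ∀ e f → Dec (∃[ v ] (Incident G v e × Incident G v f))
commonEnd? G e f = map′ witness endOf (incident? G u f ⊎-dec incident? G w f)
  where
  u = proj₁ (ends G e)
  w = proj₂ (ends G e)

  witness : Incident G u f ⊎ Incident G w f → ∃[ v ] (Incident G v e × Incident G v f)
  witness (inj₁ u∈f) = u , inj₁ refl , u∈f
  witness (inj₂ w∈f) = w , inj₂ refl , w∈f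

  endOf : ∃[ v ] (Incident G v e × Incident G v f) → Incident G u f ⊎ Incident G w f
  endOf (_ , inj₁ refl , v∈f) = inj₁ v∈f
  endOf (_ , inj₂ refl , v∈f) = inj₂ v∈f

adjacent? : (G : Graph) → Decidable (Adjacent G)
adjacent? G e f = ¬? (e ≟ f) ×-dec commonEnd? G e f

module Colourings (G : Graph) (k : ℕ) where

  infix 4 _⊑_
  infixl 6 _[_≔_]

  _[_≔_] : State G k → Fin (E G) → Fin k → State G k
  s [ e ≔ c ] = update {G} s e c

  Proper : State G k → Set
  Proper s = ∀ {e f c} → Adjacent G e f → s e ≡ just c → s f ≢ just c

  _⊑_ : State G k → State G k → Set
  s ⊑ u = ∀ {e c} → s e ≡ just c → u e ≡ just c

  Extendable : State G k → Set
  Extendable s = ∃[ u ] (Complete {G} {k} u × Proper u × s ⊑ u)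

  empty-proper : Proper (empty {G} {k})
  empty-proper _ ()

  empty-legal : ∀ e c → Legal {G} (empty {G} {k}) e c
  empty-legal e c = refl , λ _ _ ()

  update-just : ∀ s e c {f d} → (s [ e ≔ c ]) f ≡ just d → (f ≡ e × c ≡ d) ⊎ s f ≡ just d
  update-just s e c {f} eq with f ≟ e
  ... | yes f≡e = inj₁ (f≡e , just-injective eq)
  ... | no _    = inj₂ eq

  ⊑-update : ∀ {s e} c → s e ≡ nothing → s ⊑ s [ e ≔ c ]
  ⊑-update {s} {e} c fresh {f} eq with f ≟ e
  ... | yes refl = contradiction (trans (sym fresh) eq) λ ()
  ... | no _     = eq

  update-cong : ∀ {s s′ : State G k} e c → s ≗ s′ → s [ e ≔ c ] ≗ s′ [ e ≔ c ]
  update-cong e c s≗s′ f with f ≟ e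
  ... | yes _ = refl
  ... | no _  = s≗s′ f

  update-proper : ∀ {s e c} → Legal {G} s e c → Proper s → Proper (s [ e ≔ c ])
  update-proper {s} {e} {c} (_ , unused) proper {e₁} {f₁} adj eq₁ eq₂
    with update-just s e c {e₁} eq₁ | update-just s e c {f₁} eq₂
  ... | inj₁ (refl , _)    | inj₁ (refl , _)    = proj₁ adj refl
  ... | inj₁ (refl , refl) | inj₂ eq₂′          = unused f₁ adj eq₂′
  ... | inj₂ eq₁′          | inj₁ (refl , refl) = unused e₁ (Adjacent-sym adj) eq₁′
  ... | inj₂ eq₁′          | inj₂ eq₂′          = proper adj eq₁′ eq₂′

  Extendable-update⁻ : ∀ {s e c} → Legal {G} s e c → Extendable (s [ e ≔ c ]) → Extendable s
  Extendable-update⁻ {s} {e} {c} (fresh , _) (u , complete , proper , s′⊑u) =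
    u , complete , proper , λ eq → s′⊑u (⊑-update {s} {e} c fresh eq)

  Extendable-step : ∀ {s e} → Extendable s → s e ≡ nothing →
                    ∃[ c ] (Legal {G} s e c × Extendable (s [ e ≔ c ]))
  Extendable-step {s} {e} (u , complete , proper , s⊑u) fresh with u e in ue
  ... | nothing = contradiction ue (complete e)
  ... | just c  = c , (fresh , λ f adj sf → proper adj ue (s⊑u sf)) , u , complete , proper , s′⊑u
    where
    s′⊑u : s [ e ≔ c ] ⊑ u
    s′⊑u {f} eq with update-just s e c {f} eq
    ... | inj₁ (refl , refl) = ue
    ... | inj₂ eq′           = s⊑u eq′

  Complete⇒coloured : ∀ {u : State G k} → Complete {G} {k} u → ∀ e → ∃[ c ] u e ≡ just c
  Complete⇒coloured {u} complete e with u e in eq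
  ... | just c  = c , refl
  ... | nothing = contradiction eq (complete e)

  MakerWins⇒Extendable : ∀ {m t s} → MakerWins G m k t s → Proper s → Extendable s
  MakerWins⇒Extendable (done complete) proper = _ , complete , proper , id
  MakerWins⇒Extendable (maker e c legal w) proper =
    Extendable-update⁻ legal (MakerWins⇒Extendable w (update-proper legal proper))
  MakerWins⇒Extendable (breaker (e , c , legal) respond) proper =
    Extendable-update⁻ legal (MakerWins⇒Extendable (respond e c legal) (update-proper legal proper))

  Legal-resp-≗ : ∀ {s s′ : State G k} {e c} → s ≗ s′ → Legal {G} s e c → Legal {G} s′ e c
  Legal-resp-≗ {e = e} s≗s′ (fresh , unused) =
    trans (sym (s≗s′ e)) fresh , λ f adj eq → unused f adj (trans (s≗s′ f) eq)

  MakerWins-resp-≗ : ∀ {m t} {s s′ : State G k} → s ≗ s′ → MakerWins G m k t s → MakerWins G m k t s′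
  MakerWins-resp-≗ s≗s′ (done complete) = done λ e → complete e ∘ trans (s≗s′ e)
  MakerWins-resp-≗ s≗s′ (maker e c legal w) =
    maker e c (Legal-resp-≗ s≗s′ legal) (MakerWins-resp-≗ (update-cong e c s≗s′) w)
  MakerWins-resp-≗ s≗s′ (breaker (e , c , legal) respond) =
    breaker (e , c , Legal-resp-≗ s≗s′ legal) λ e c legal →
      MakerWins-resp-≗ (update-cong e c s≗s′) (respond e c (Legal-resp-≗ (sym ∘ s≗s′) legal))

  MakerWins-finish : ∀ {m} es {s} → (∀ e → s e ≡ nothing → e ∈ es) → Extendable s →
              ∀ r → length es ≤ r → MakerWins G m k (afterMaker r) s
  MakerWins-finish [] uncoloured ext r _ = done λ e fresh → contradiction (uncoloured e fresh) λ ()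
  MakerWins-finish (e ∷ es) {s} uncoloured ext r len with s e in se
  ... | just _ = MakerWins-finish es later ext r (≤-trans (n≤1+n _) len)
    where
    later : ∀ f → s f ≡ nothing → f ∈ es
    later f fresh with uncoloured f fresh
    ... | here refl = contradiction (trans (sym fresh) se) λ ()
    ... | there f∈es = f∈es
  ... | nothing with Extendable-step ext se | r | len
  ...   | c , legal , ext′ | suc r′ | s≤s len′ = maker e c legal (MakerWins-finish es later ext′ r′ len′)
    where
    later : ∀ f → (s [ e ≔ c ]) f ≡ nothing → f ∈ es
    later f fresh with f ≟ e | uncoloured f
    ... | yes refl | _       = contradiction fresh λ ()
    ... | no f≢e   | f∈e∷es with f∈e∷es fresh
    ...   | here f≡e   = contradiction f≡e f≢e
    ...   | there f∈es = f∈es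

  MakerWinsGame-E≤m : ∀ {m} → Extendable (empty {G} {k}) → E G ≤ suc m → MakerWinsGame G (suc m) k
  MakerWinsGame-E≤m {m} ext E≤m =
    MakerWins-finish (allFin (E G)) (λ e _ → ∈-allFin e) ext (suc m)
      (subst (_≤ suc m) (sym (length-tabulate id)) E≤m)

  -- The colour of f is tested before adjacency: it is the cheaper test and
  -- usually settles the case.
  legal? : ∀ s e c → Dec (Legal {G} {k} s e c)
  legal? s e c = ≡-dec _≟_ (s e) nothing ×-dec
                 all? λ f → map′ flip flip (≡-dec _≟_ (s f) (just c) →-dec ¬? (adjacent? G e f))

  complete? : ∀ s → Dec (Complete {G} {k} s)
  complete? s = all? λ e → ¬? (≡-dec _≟_ (s e) nothing)

  legalᵇ : State G k → Fin (E G) → Fin k → Bool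
  legalᵇ s e c = does (legal? s e c)

  legalᵇ⇒Legal : ∀ {s e c} → T (legalᵇ s e c) → Legal {G} s e c
  legalᵇ⇒Legal {s} {e} {c} = does⇒ (legal? s e c)

  Legal⇒legalᵇ : ∀ {s e c} → Legal {G} s e c → T (legalᵇ s e c)
  Legal⇒legalᵇ {s} {e} {c} = ⇒does (legal? s e c)

module Recolouring (G : Graph) {k : ℕ} (σ : Permutation′ k) where

  open Colourings G k

  recolour : State G k → State G k
  recolour s = Maybe.map (σ ⟨$⟩ʳ_) ∘ s

  recolour-update : ∀ s e c → recolour (s [ e ≔ c ]) ≗ recolour s [ e ≔ σ ⟨$⟩ʳ c ]
  recolour-update s e c f with f ≟ e
  ... | yes _ = refl
  ... | no _  = refl

  σ-injective : ∀ {a b} → σ ⟨$⟩ʳ a ≡ σ ⟨$⟩ʳ b → a ≡ b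
  σ-injective {a} {b} eq = begin
    a                   ≡⟨ inverseˡ σ ⟨
    σ ⟨$⟩ˡ (σ ⟨$⟩ʳ a)   ≡⟨ cong (σ ⟨$⟩ˡ_) eq ⟩
    σ ⟨$⟩ˡ (σ ⟨$⟩ʳ b)   ≡⟨ inverseˡ σ ⟩
    b                   ∎

  recolour-nothing : ∀ x → Maybe.map (σ ⟨$⟩ʳ_) x ≡ nothing → x ≡ nothing
  recolour-nothing nothing _ = refl

  recolour-just : ∀ x {c} → Maybe.map (σ ⟨$⟩ʳ_) x ≡ just (σ ⟨$⟩ʳ c) → x ≡ just c
  recolour-just (just d) eq = cong just (σ-injective (just-injective eq))

  recolour-Legal : ∀ {s e c} → Legal {G} s e c → Legal {G} (recolour s) e (σ ⟨$⟩ʳ c)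
  recolour-Legal {s} (fresh , unused) =
    map-nothing fresh , λ f adj → unused f adj ∘ recolour-just (s f)

  recolour-Legal⁻ : ∀ {s e c} → Legal {G} (recolour s) e c → Legal {G} s e (σ ⟨$⟩ˡ c)
  recolour-Legal⁻ {s} {e} (fresh , unused) =
    recolour-nothing (s e) fresh ,
    λ f adj eq → unused f adj (trans (cong (Maybe.map (σ ⟨$⟩ʳ_)) eq) (cong just (inverseʳ σ)))

  MakerWins-recolour : ∀ {m t s} → MakerWins G m k t s → MakerWins G m k t (recolour s)
  MakerWins-recolour {s = s} (done complete) = done λ e → complete e ∘ recolour-nothing (s e)
  MakerWins-recolour {s = s} (maker e c legal w) =
    maker e (σ ⟨$⟩ʳ c) (recolour-Legal legal)
      (MakerWins-resp-≗ (recolour-update s e c) (MakerWins-recolour w))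
  MakerWins-recolour {s = s} (breaker (e , c , legal) respond) =
    breaker (e , σ ⟨$⟩ʳ c , recolour-Legal legal) λ e′ c′ legal′ →
      MakerWins-resp-≗ (moved e′ c′) (MakerWins-recolour (respond e′ (σ ⟨$⟩ˡ c′) (recolour-Legal⁻ legal′)))
    where
    moved : ∀ e′ c′ → recolour (s [ e′ ≔ σ ⟨$⟩ˡ c′ ]) ≗ recolour s [ e′ ≔ c′ ]
    moved e′ c′ f rewrite recolour-update s e′ (σ ⟨$⟩ˡ c′) f | inverseʳ σ {c′} = refl

MakerWins-firstColour : ∀ {G m k r e} c c₀ → let open Colourings G k in
  MakerWins G m k (afterMaker r) (empty {G} [ e ≔ c ]) →
  MakerWins G m k (afterMaker r) (empty {G} [ e ≔ c₀ ])
MakerWins-firstColour {G} {k = k} {e = e} c c₀ w =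
  MakerWins-resp-≗ moved (MakerWins-recolour w)
  where
  open Colourings G k
  open Recolouring G (transpose c c₀)
  moved : recolour (empty {G} [ e ≔ c ]) ≗ empty {G} [ e ≔ c₀ ]
  moved f rewrite recolour-update (empty {G}) e c f | dec-true (c ≟ c) refl = refl

-- The searches return booleans rather than decisions: evaluating `does` of
-- composite Dec values is far slower, and only the boolean is ever computed.
module Search (G : Graph) (m k : ℕ) where

  open Colourings G k

  mutual
    wins : ℕ → Turn → State G k → Bool
    wins n t s = does (complete? s) ∨ moves n t s

    moves : ℕ → Turn → State G k → Bool
    moves zero    _                   _ = false
    moves (suc n) (makerTurn zero)    _ = false
    moves (suc n) (makerTurn (suc r)) s =
      anyᶠ λ e → anyᶠ λ c → legalᵇ s e c ∧ wins n (afterMaker r) (s [ e ≔ c ])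
    moves (suc n) breakerTurn s =
      (anyᶠ λ e → anyᶠ λ c → legalᵇ s e c) ∧
      (allᶠ λ e → allᶠ λ c → not (legalᵇ s e c) ∨ wins n (makerTurn m) (s [ e ≔ c ]))

  mutual
    wins⇒MakerWins : ∀ n t s → T (wins n t s) → MakerWins G m k t s
    wins⇒MakerWins n t s h with Equivalence.to T-∨ h
    ... | inj₁ complete = done (does⇒ (complete? s) complete)
    ... | inj₂ h′       = moves⇒MakerWins n t s h′

    moves⇒MakerWins : ∀ n t s → T (moves n t s) → MakerWins G m k t s
    moves⇒MakerWins (suc n) (makerTurn (suc r)) s h =
      let e , h₁ = anyᶠ⁻ _ h
          c , h₂ = anyᶠ⁻ _ h₁
          legal , h₃ = Equivalence.to T-∧ h₂
      in  maker e c (legalᵇ⇒Legal legal) (wins⇒MakerWins n _ _ h₃)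
    moves⇒MakerWins (suc n) breakerTurn s h =
      let h₁ , h₂ = Equivalence.to T-∧ h
          e , h₃ = anyᶠ⁻ _ h₁
          c , legal = anyᶠ⁻ _ h₃
      in  breaker (e , c , legalᵇ⇒Legal legal) λ e c legal →
            wins⇒MakerWins n _ _ (T-⇒ (allᶠ⁻ _ (allᶠ⁻ _ h₂ e) c) (Legal⇒legalᵇ legal))

  uncompletable : List (Fin (E G)) → State G k → Bool
  uncompletable []       s = false
  uncompletable (e ∷ es) s with s e
  ... | just _  = uncompletable es s
  ... | nothing = allᶠ λ c → not (legalᵇ s e c) ∨ uncompletable es (s [ e ≔ c ])

  uncompletable⇒¬Extendable : ∀ es s → T (uncompletable es s) → ¬ Extendable s
  uncompletable⇒¬Extendable (e ∷ es) s h ext with s e in fresh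
  ... | just _  = uncompletable⇒¬Extendable es s h ext
  ... | nothing =
    let c , legal , ext′ = Extendable-step ext fresh
    in  uncompletable⇒¬Extendable es _ (T-⇒ (allᶠ⁻ _ h c) (Legal⇒legalᵇ legal)) ext′

  spoils : State G k → Bool
  spoils s = anyᶠ λ e → anyᶠ λ c → legalᵇ s e c ∧ uncompletable (allFin (E G)) (s [ e ≔ c ])

  mutual
    spoilsTurn : ℕ → State G k → Bool
    spoilsTurn zero    s = false
    spoilsTurn (suc r) s = not (does (complete? s)) ∧
      (allᶠ λ e → allᶠ λ c → not (legalᵇ s e c) ∨ spoilsAfter r (s [ e ≔ c ]))

    spoilsAfter : ℕ → State G k → Bool
    spoilsAfter zero    = spoils
    spoilsAfter (suc r) = spoilsTurn (suc r)

  spoils⇒¬MakerWins : ∀ s → T (spoils s) → Proper s → ¬ MakerWins G m k breakerTurn s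
  spoils⇒¬MakerWins s h proper w with anyᶠ⁻ _ h
  ... | e , h₁ with anyᶠ⁻ _ h₁
  ... | c , h₂ with Equivalence.to T-∧ h₂ | w
  ... | legal , _     | done complete     = complete e (proj₁ (legalᵇ⇒Legal {s} {e} {c} legal))
  ... | legal , stuck | breaker _ respond =
    let legal′ = legalᵇ⇒Legal {s} {e} {c} legal
    in  uncompletable⇒¬Extendable (allFin (E G)) _ stuck
          (MakerWins⇒Extendable (respond e c legal′) (update-proper legal′ proper))

  mutual
    spoilsTurn⇒¬MakerWins : ∀ r s → T (spoilsTurn r s) → Proper s → ¬ MakerWins G m k (makerTurn r) s
    spoilsTurn⇒¬MakerWins (suc r) s h proper w with Equivalence.to T-∧ h | w
    ... | incomplete , _ | done complete = does⇒ (¬? (complete? s)) incomplete complete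
    ... | _ , h′ | maker e c legal w′ =
      spoilsAfter⇒¬MakerWins r _ (T-⇒ (allᶠ⁻ _ (allᶠ⁻ _ h′ e) c) (Legal⇒legalᵇ legal))
        (update-proper legal proper) w′

    spoilsAfter⇒¬MakerWins : ∀ r s → T (spoilsAfter r s) → Proper s → ¬ MakerWins G m k (afterMaker r) s
    spoilsAfter⇒¬MakerWins zero    = spoils⇒¬MakerWins
    spoilsAfter⇒¬MakerWins (suc r) = spoilsTurn⇒¬MakerWins (suc r)

  ¬MakerWins-firstColour : ∀ r (e₀ : Fin (E G)) c₀ →
    T (allᶠ λ e → spoilsAfter r (empty {G} [ e ≔ c₀ ])) → ¬ MakerWins G m k (makerTurn (suc r)) (empty {G})
  ¬MakerWins-firstColour r e₀ c₀ _       (done complete) = complete e₀ refl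
  ¬MakerWins-firstColour r e₀ c₀ spoiled (maker e c _ w) =
    spoilsAfter⇒¬MakerWins r _ (allᶠ⁻ (λ e → spoilsAfter r (empty {G} [ e ≔ c₀ ])) spoiled e)
      (update-proper (empty-legal e c₀) empty-proper) (MakerWins-firstColour c c₀ w)

  wins⇒MakerWinsGame : T (wins (E G) (makerTurn m) (empty {G})) → MakerWinsGame G m k
  wins⇒MakerWinsGame = wins⇒MakerWins (E G) (makerTurn m) (empty {G})

spoke : ∀ {n} → Fin n → Fin (E (wheel n))
spoke {n} i = i ↑ˡ n

hub-incident-spoke : ∀ {n} (i : Fin n) → Incident (wheel n) zero (spoke i)
hub-incident-spoke {n} i rewrite splitAt-↑ˡ n i n = inj₁ refl

spokes-adjacent : ∀ {n} {i j : Fin n} → i ≢ j → Adjacent (wheel n) (spoke i) (spoke j)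
spokes-adjacent {n} {i} {j} i≢j =
  i≢j ∘ ↑ˡ-injective n i j , zero , hub-incident-spoke i , hub-incident-spoke j

module _ {n k : ℕ} where

  open Colourings (wheel n) k

  wheel-colouring⇒n≤k : ∀ {u} → Complete {wheel n} {k} u → Proper u → n ≤ k
  wheel-colouring⇒n≤k {u} complete proper = ≮⇒≥ λ k<n →
    let i , j , i<j , same = pigeonhole k<n (proj₁ ∘ colour ∘ spoke)
    in  proper (spokes-adjacent (<⇒≢ i<j)) (proj₂ (colour (spoke i)))
          (trans (proj₂ (colour (spoke j))) (cong just (sym same)))
    where
    colour : ∀ e → ∃[ c ] u e ≡ just c
    colour = Complete⇒coloured complete

  MakerWinsGame-wheel⇒n≤k : ∀ {m} → MakerWinsGame (wheel n) m k → n ≤ k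
  MakerWinsGame-wheel⇒n≤k w =
    let _ , complete , proper , _ = MakerWins⇒Extendable w empty-proper
    in  wheel-colouring⇒n≤k complete proper

¬MakerWinsGame-wheel-<n : ∀ {n m} j → j < n → ¬ MakerWinsGame (wheel n) m j
¬MakerWinsGame-wheel-<n j j<n = <⇒≱ j<n ∘ MakerWinsGame-wheel⇒n≤k

-- Each `_ : T b` below, for a closed boolean b, is found by evaluating b to true.
W₃-makerWins : ∀ m → 2 ≤ m → MakerWinsGame (wheel 3) m 3
W₃-makerWins 1 (s≤s ())
W₃-makerWins 2 _ = Search.wins⇒MakerWinsGame (wheel 3) 2 3 _
W₃-makerWins 3 _ = Search.wins⇒MakerWinsGame (wheel 3) 3 3 _
W₃-makerWins 4 _ = Search.wins⇒MakerWinsGame (wheel 3) 4 3 _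
W₃-makerWins 5 _ = Search.wins⇒MakerWinsGame (wheel 3) 5 3 _
W₃-makerWins (suc (suc (suc (suc (suc (suc r)))))) _ =
  MakerWinsGame-E≤m (MakerWins⇒Extendable (W₃-makerWins 2 (s≤s (s≤s z≤n))) empty-proper) (m≤m+n 6 r)
  where open Colourings (wheel 3) 3

W₄-makerWins : ∀ m → 2 ≤ m → m ≢ 3 → MakerWinsGame (wheel 4) m 4
W₄-makerWins 1 (s≤s ()) _
W₄-makerWins 2 _ _ = Search.wins⇒MakerWinsGame (wheel 4) 2 4 _
W₄-makerWins 3 _ m≢3 = contradiction refl m≢3
W₄-makerWins 4 _ _ = Search.wins⇒MakerWinsGame (wheel 4) 4 4 _
W₄-makerWins 5 _ _ = Search.wins⇒MakerWinsGame (wheel 4) 5 4 _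
W₄-makerWins 6 _ _ = Search.wins⇒MakerWinsGame (wheel 4) 6 4 _
W₄-makerWins 7 _ _ = Search.wins⇒MakerWinsGame (wheel 4) 7 4 _
W₄-makerWins (suc (suc (suc (suc (suc (suc (suc (suc r)))))))) _ _ =
  MakerWinsGame-E≤m (MakerWins⇒Extendable (W₄-makerWins 2 (s≤s (s≤s z≤n)) λ ()) empty-proper) (m≤m+n 8 r)
  where open Colourings (wheel 4) 4

W₄-breakerWins-m≡3 : ¬ MakerWinsGame (wheel 4) 3 4
W₄-breakerWins-m≡3 = Search.¬MakerWins-firstColour (wheel 4) 3 4 2 zero zero _

W₄-makerWins-m≡3-5colours : MakerWinsGame (wheel 4) 3 5
W₄-makerWins-m≡3-5colours = Search.wins⇒MakerWinsGame (wheel 4) 3 5 _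

theorem4p2 : ∀ (m : ℕ) → 2 ≤ m →
    GameChromaticIndex≡ (wheel 3) m 3
    × (m ≢ 3 → GameChromaticIndex≡ (wheel 4) m 4)
    × (m ≡ 3 → GameChromaticIndex≡ (wheel 4) m 5)
theorem4p2 m 2≤m =
  (W₃-makerWins m 2≤m , ¬MakerWinsGame-wheel-<n)
  , (λ m≢3 → W₄-makerWins m 2≤m m≢3 , ¬MakerWinsGame-wheel-<n)
  , λ { refl → W₄-makerWins-m≡3-5colours , belowFive }
  where
  belowFive : ∀ j → j < 5 → ¬ MakerWinsGame (wheel 4) 3 j
  belowFive j j<5 w = W₄-breakerWins-m≡3
    (subst (MakerWinsGame (wheel 4) 3) (≤-antisym (≤-pred j<5) (MakerWinsGame-wheel⇒n≤k w)) w)
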